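{- Let $G=(V,E)$ be a graph whose edges arrive as a stream, let $M_0$ be a maximal matching of $G$, let $M^*$ be a maximum matching of $G$, and let $\lambda_U, \lambda_M \ge 1$ be integers, with $\lambda_M \ge 2$ if $G$ is not triangle-free. Run one pass of the procedure $\textsc{Improve-Matching}(M_0,\lambda_U,\lambda_M)$ described below. Then the number of bad edges of $M_0$ is at most $\lambda_M |M_0|/\lambda_U$.
   Context: Procedure $\textsc{Improve-Matching}(M_0,\lambda_U,\lambda_M)$ (one pass over the stream): initialize $M \leftarrow M_0$, $S\leftarrow\emptyset$, $I \leftarrow \emptyset$, $I_B \leftarrow\emptyset$. For each arriving edge $xy$: if $x$ or $y$ lies in $I\cup I_B$, ignore it; else if both $x,y \in V(M_0)$, ignore it; otherwise name the endpoints so that $x \notin V(M_0)$ and $y \in V(M_0)$. If there exist $v,b$ with $yv \in M_0$, $vb \in S$ and $b \neq x$ (i.e. $xy$ closes a 3-augmenting path $x\,y\,v\,b$), then set $M \leftarrow (M\setminus\{yv\})\cup\{xy,vb\}$, let $I_x = \{u_x,v_x : xu_x\in S,\ u_xv_x \in M_0\}$ and $I_b=\{u_b,v_b : u_bv_b\in M_0,\ v_bb\in S\}$, and set $I\leftarrow I\cup\{x,y,v,b\}$, $I_B \leftarrow I_B\cup I_x\cup I_b$. Otherwise, if $\deg_S(x)<\lambda_U$ and $\deg_S(y)<\lambda_M$, add $xy$ to $S$ (edges are never removed from $S$). At the end return $M$. Here $V(F)$ is the set of vertices covered by $F$ and $\deg_S(v)$ the number of $S$-edges at $v$. An edge $uv\in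 M_0$ is 3-augmentable if the connected component of $M_0\cup M^*$ containing it is a path $a\,u\,v\,b$ with $au,vb \in M^*$; name it so that $au$ arrives in the stream before $vb$. The edge $uv \in M_0$ is good if it gets augmented (removed from $M$) during the procedure. A 3-augmentable edge $uv$ is bad if it is not good and either $\deg_S(a)=\lambda_U$ at the moment $au$ arrives or $\deg_S(b)=\lambda_U$ at the moment $vb$ arrives. -}

module Defs where

open import Data.Nat using (ℕ; zero; suc; _+_; _*_; _≤_; _<_; _≡ᵇ_)
open import Data.Bool using (if_then_else_; _∨_)
open import Data.Product using (_×_; _,_; Σ; ∃; ∃-syntax)
open import Data.Sum using (_⊎_)
open import Data.Empty using (⊥)
open import Data.List using (List; []; _∷_; length)
open import Data.List.Membership.Propositional using (_∈_)
open import Data.List.Relation.Unary.All using (All)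
open import Data.List.Relation.Unary.AllPairs using (AllPairs)
open import Relation.Nullary using (¬_)
open import Relation.Binary.PropositionalEquality using (_≡_; _≢_)

-- Graphs given as edge streams. Vertices are natural numbers, an edge
-- is an (unordered) pair, stored as an ordered pair in arrival form.

Vertex : Set
Vertex = ℕ

Edge : Set
Edge = Vertex × Vertex

SameEdge : Edge → Edge → Set
SameEdge (p , q) (r , s) = (p ≡ r × q ≡ s) ⊎ (p ≡ s × q ≡ r)

_∈ₑ_ : Edge → List Edge → Set
e ∈ₑ L = ∃[ f ] (f ∈ L × SameEdge e f)

Incident : Vertex → Edge → Set
Incident w (p , q) = w ≡ p ⊎ w ≡ q

Covered : List Edge → Vertex → Set
Covered F w = ∃[ e ] (e ∈ F × Incident w e)

SimpleStream : List Edge → Set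
SimpleStream L = All (λ { (p , q) → p ≢ q }) L × AllPairs (λ e f → ¬ SameEdge e f) L

VertexDisjoint : Edge → Edge → Set
VertexDisjoint (p , q) (r , s) = p ≢ r × p ≢ s × q ≢ r × q ≢ s

IsMatching : List Edge → List Edge → Set
IsMatching L M = All (λ e → e ∈ₑ L) M × AllPairs VertexDisjoint M

IsMaximalMatching : List Edge → List Edge → Set
IsMaximalMatching L M =
  IsMatching L M × (∀ e → e ∈ L → ∃[ f ] (f ∈ M × ∃[ w ] (Incident w e × Incident w f)))

IsMaximumMatching : List Edge → List Edge → Set
IsMaximumMatching L M = IsMatching L M × (∀ M' → IsMatching L M' → length M' ≤ length M)

TriangleFree : List Edge → Set
TriangleFree L = ∀ x y z → (x , y) ∈ₑ L → (y , z) ∈ₑ L → (x , z) ∈ₑ L → ⊥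

degS : Vertex → List Edge → ℕ
degS v [] = 0
degS v ((p , q) ∷ S) = (if (v ≡ᵇ p) ∨ (v ≡ᵇ q) then 1 else 0) + degS v S

-- State: the current matching M and the sets I, I_B are given as
-- predicates (sets); S is a list (needed for degrees).
record State : Set₁ where
  field
    M  : Edge → Set
    S  : List Edge
    I  : Vertex → Set
    IB : Vertex → Set
open State public

initState : List Edge → State
initState M0 = record { M = λ e → e ∈ₑ M0 ; S = [] ; I = λ _ → ⊥ ; IB = λ _ → ⊥ }

Blocked : State → Vertex → Set
Blocked st w = I st w ⊎ IB st w

-- xy closes a 3-augmenting path x y v b
Closes : List Edge → State → Vertex → Vertex → Vertex → Vertex → Set
Closes M0 st x y v b = (y , v) ∈ₑ M0 × (v , b) ∈ₑ S st × b ≢ x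

augment : List Edge → State → Vertex → Vertex → Vertex → Vertex → State
augment M0 st x y v b = record
  { M  = λ e → (M st e × ¬ SameEdge e (y , v)) ⊎ SameEdge e (x , y) ⊎ SameEdge e (v , b)
  ; S  = S st
  ; I  = λ w → I st w ⊎ w ≡ x ⊎ w ≡ y ⊎ w ≡ v ⊎ w ≡ b
  ; IB = λ w → IB st w
              ⊎ (∃[ ux ] ∃[ vx ] ((x , ux) ∈ₑ S st × (ux , vx) ∈ₑ M0 × (w ≡ ux ⊎ w ≡ vx)))
              ⊎ (∃[ ub ] ∃[ vb ] ((ub , vb) ∈ₑ M0 × (vb , b) ∈ₑ S st × (w ≡ ub ⊎ w ≡ vb)))
  }

-- one step of the procedure on an arriving edge (a relation, since the
-- choice of v, b in the augmenting case may be nondeterministic)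
data Step (M0 : List Edge) (lamU lamM : ℕ) (st : State) : Edge → State → Set₁ where
  ignore-blocked : ∀ {p q} → Blocked st p ⊎ Blocked st q → Step M0 lamU lamM st (p , q) st
  ignore-M0 : ∀ {p q} → ¬ Blocked st p → ¬ Blocked st q →
              Covered M0 p → Covered M0 q → Step M0 lamU lamM st (p , q) st
  aug : ∀ {e x y} v b → SameEdge e (x , y) → ¬ Blocked st x → ¬ Blocked st y →
        ¬ Covered M0 x → Covered M0 y → Closes M0 st x y v b →
        Step M0 lamU lamM st e (augment M0 st x y v b)
  add : ∀ {e x y} → SameEdge e (x , y) → ¬ Blocked st x → ¬ Blocked st y →
        ¬ Covered M0 x → Covered M0 y → ¬ (∃[ v ] ∃[ b ] Closes M0 st x y v b) →
        degS x (S st) < lamU → degS y (S st) < lamM →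
        Step M0 lamU lamM st e (record st { S = (x , y) ∷ S st })
  skip : ∀ {e x y} → SameEdge e (x , y) → ¬ Blocked st x → ¬ Blocked st y →
         ¬ Covered M0 x → Covered M0 y → ¬ (∃[ v ] ∃[ b ] Closes M0 st x y v b) →
         ¬ (degS x (S st) < lamU × degS y (S st) < lamM) →
         Step M0 lamU lamM st e st

-- A run of the one-pass procedure over a stream. The history records,
-- for every arriving edge, the state at the moment it arrives (before
-- it is processed); the last index is the final state.
data Run (M0 : List Edge) (lamU lamM : ℕ) : State → List Edge → List (Edge × State) → State → Set₁ where
  done : ∀ {st} → Run M0 lamU lamM st [] [] st
  step : ∀ {st st' e es h fin} → Step M0 lamU lamM st e st' →
         Run M0 lamU lamM st' es h fin →
         Run M0 lamU lamM st (e ∷ es) ((e , st) ∷ h) fin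

-- The connected component of M0 ∪ M* containing uv is the path a u v b
-- with au, vb ∈ M*: the four vertices are distinct, the three edges are
-- present, and every edge of M0 ∪ M* touching {a,u,v,b} is one of them.
ComponentIsPath : List Edge → List Edge → Vertex → Vertex → Vertex → Vertex → Set
ComponentIsPath M0 Mstar a u v b =
  (a ≢ u × a ≢ v × a ≢ b × u ≢ v × u ≢ b × v ≢ b) ×
  (u , v) ∈ₑ M0 × (a , u) ∈ₑ Mstar × (v , b) ∈ₑ Mstar ×
  (∀ e → (e ∈ₑ M0 ⊎ e ∈ₑ Mstar) →
         (Incident a e ⊎ Incident u e ⊎ Incident v e ⊎ Incident b e) →
         SameEdge e (a , u) ⊎ SameEdge e (u , v) ⊎ SameEdge e (v , b))

-- good: uv has been augmented, i.e. removed from M (by the end)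
Good : State → Edge → Set
Good fin e = ¬ M fin e

DegFullAtArrival : ℕ → List (Edge × State) → Edge → Vertex → Set₁
DegFullAtArrival lamU h e w =
  ∃[ e' ] ∃[ st ] ((e' , st) ∈ h × SameEdge e' e × degS w (S st) ≡ lamU)

Bad : List Edge → List Edge → ℕ → List (Edge × State) → State → Edge → Set₁
Bad M0 Mstar lamU h fin e =
  Σ Vertex λ a → Σ Vertex λ u → Σ Vertex λ v → Σ Vertex λ b →
    SameEdge e (u , v) × ComponentIsPath M0 Mstar a u v b ×
    ¬ Good fin (u , v) ×
    (DegFullAtArrival lamU h (a , u) a ⊎ DegFullAtArrival lamU h (v , b) b)

-- Every S-edge joins a vertex outside V(M0) to one inside, and S-edges are only added at
-- vertices of S-degree below λM. Two S-edges c p and b q with pq ∈ M0 and c ≠ b cannot both be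
-- present: the later one would have closed the 3-augmenting path. So if both ends of an M0-edge
-- carry S-edges, they all go to one vertex c; then each end has S-degree 1 and c p q is a
-- triangle, which is excluded unless λM ≥ 2. Either way the ends of an M0-edge carry at most λM
-- S-edges, whence |S| ≤ λM |M0|.
-- Conversely, a bad edge has an end of its path, exposed by M0 and M*-matched into the edge,
-- whose S-degree reached λU and never decreased. Distinct bad edges give distinct such vertices,
-- and an S-edge meets at most one of them, since its other endpoint lies in V(M0). Hence
-- λU · #bad ≤ |S|.
module Submission where

open import Defs
open import Algebra.Properties.CommutativeSemigroup using (interchange)
open import Data.Bool using (true; false; T; if_then_else_; _∨_)
open import Data.Empty using (⊥; ⊥-elim)
open import Data.List using (List; []; _∷_; length; map)
open import Data.List.Membership.Propositional using (_∈_)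
open import Data.List.Relation.Binary.Sublist.Propositional using (_⊆_; []; _∷_; _∷ʳ_)
open import Data.List.Relation.Binary.Sublist.Propositional.Properties using (All-resp-⊆)
open import Data.List.Relation.Unary.All as All using (All; []; _∷_; reduce)
open import Data.List.Relation.Unary.AllPairs as AllPairs using (AllPairs; []; _∷_)
open import Data.List.Relation.Unary.Any using (here; there)
open import Data.List.Relation.Unary.Unique.Propositional using (Unique)
open import Data.Nat using (ℕ; zero; suc; _+_; _*_; _≤_; _<_; _≡ᵇ_; _≟_; z≤n; s≤s)
open import Data.Nat.ListAction using (sum)
open import Data.Nat.Properties
open import Data.Product using (_×_; _,_; ∃; ∃-syntax; proj₁; proj₂)
open import Data.Sum using (_⊎_; inj₁; inj₂; [_,_]′)
open import Data.Unit using (tt)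
open import Function using (_∘_)
open import Relation.Nullary using (¬_; yes; no)
open import Relation.Binary.PropositionalEquality

Distinct : Edge → Edge → Set
Distinct e f = ¬ SameEdge e f

SameEdge-refl : ∀ e → SameEdge e e
SameEdge-refl _ = inj₁ (refl , refl)

SameEdge-sym : ∀ {e f} → SameEdge e f → SameEdge f e
SameEdge-sym (inj₁ (p≡r , q≡s)) = inj₁ (sym p≡r , sym q≡s)
SameEdge-sym (inj₂ (p≡s , q≡r)) = inj₂ (sym q≡r , sym p≡s)

SameEdge-trans : ∀ {e f g} → SameEdge e f → SameEdge f g → SameEdge e g
SameEdge-trans (inj₁ (a , b)) (inj₁ (c , d)) = inj₁ (trans a c , trans b d)
SameEdge-trans (inj₁ (a , b)) (inj₂ (c , d)) = inj₂ (trans a c , trans b d)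
SameEdge-trans (inj₂ (a , b)) (inj₁ (c , d)) = inj₂ (trans a d , trans b c)
SameEdge-trans (inj₂ (a , b)) (inj₂ (c , d)) = inj₁ (trans a d , trans b c)

SameEdge-swap : ∀ p q → SameEdge (p , q) (q , p)
SameEdge-swap _ _ = inj₂ (refl , refl)

Incident-resp : ∀ {w e f} → SameEdge e f → Incident w f → Incident w e
Incident-resp (inj₁ (p≡r , _)) (inj₁ w≡r) = inj₁ (trans w≡r (sym p≡r))
Incident-resp (inj₁ (_ , q≡s)) (inj₂ w≡s) = inj₂ (trans w≡s (sym q≡s))
Incident-resp (inj₂ (_ , q≡r)) (inj₁ w≡r) = inj₂ (trans w≡r (sym q≡r))
Incident-resp (inj₂ (p≡s , _)) (inj₂ w≡s) = inj₁ (trans w≡s (sym p≡s))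

∈⇒∈ₑ : ∀ {e F} → e ∈ F → e ∈ₑ F
∈⇒∈ₑ {e} e∈F = e , e∈F , SameEdge-refl e

∈ₑ-swap : ∀ {p q F} → (p , q) ∈ₑ F → (q , p) ∈ₑ F
∈ₑ-swap {p} {q} (f , f∈F , same) = f , f∈F , SameEdge-trans (SameEdge-swap q p) same

∈ₑ-∷⁻ : ∀ {e f F} → e ∈ₑ (f ∷ F) → SameEdge e f ⊎ e ∈ₑ F
∈ₑ-∷⁻ (_ , here refl , same) = inj₁ same
∈ₑ-∷⁻ (g , there g∈F , same) = inj₂ (g , g∈F , same)

covered₁ : ∀ {p q F} → (p , q) ∈ₑ F → Covered F p
covered₁ (f , f∈F , same) = f , f∈F , Incident-resp (SameEdge-sym same) (inj₁ refl)

covered₂ : ∀ {p q F} → (p , q) ∈ₑ F → Covered F q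
covered₂ = covered₁ ∘ ∈ₑ-swap

AllPairs-lookup : ∀ {A : Set} {R : A → A → Set} {xs x y} → AllPairs R xs → x ∈ xs → y ∈ xs →
                  x ≡ y ⊎ R x y ⊎ R y x
AllPairs-lookup (_  ∷ _)  (here refl) (here refl) = inj₁ refl
AllPairs-lookup (rx ∷ _)  (here refl) (there y∈)  = inj₂ (inj₁ (All.lookup rx y∈))
AllPairs-lookup (ry ∷ _)  (there x∈)  (here refl) = inj₂ (inj₂ (All.lookup ry x∈))
AllPairs-lookup (_  ∷ rs) (there x∈)  (there y∈)  = AllPairs-lookup rs x∈ y∈

AllPairs-resp-⊆ : ∀ {A : Set} {R : A → A → Set} {xs ys} → xs ⊆ ys → AllPairs R ys → AllPairs R xs
AllPairs-resp-⊆ []         []       = []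
AllPairs-resp-⊆ (_ ∷ʳ τ)   (_ ∷ rs) = AllPairs-resp-⊆ τ rs
AllPairs-resp-⊆ (refl ∷ τ) (r ∷ rs) = All-resp-⊆ τ r ∷ AllPairs-resp-⊆ τ rs

VertexDisjoint⇒¬shared : ∀ {w e f} → VertexDisjoint e f → Incident w e → Incident w f → ⊥
VertexDisjoint⇒¬shared (d₁ , _  , _  , _ ) (inj₁ refl) (inj₁ refl) = d₁ refl
VertexDisjoint⇒¬shared (_  , d₂ , _  , _ ) (inj₁ refl) (inj₂ refl) = d₂ refl
VertexDisjoint⇒¬shared (_  , _  , d₃ , _ ) (inj₂ refl) (inj₁ refl) = d₃ refl
VertexDisjoint⇒¬shared (_  , _  , _  , d₄) (inj₂ refl) (inj₂ refl) = d₄ refl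

matching-shared : ∀ {M e f w} → AllPairs VertexDisjoint M → e ∈ₑ M → f ∈ₑ M →
                  Incident w e → Incident w f → SameEdge e f
matching-shared M-disjoint (e′ , e′∈M , e≈e′) (f′ , f′∈M , f≈f′) w∈e w∈f
  with AllPairs-lookup M-disjoint e′∈M f′∈M
... | inj₁ refl      = SameEdge-trans e≈e′ (SameEdge-sym f≈f′)
... | inj₂ (inj₁ d) = ⊥-elim (VertexDisjoint⇒¬shared d (Incident-resp (SameEdge-sym e≈e′) w∈e)
                                                          (Incident-resp (SameEdge-sym f≈f′) w∈f))
... | inj₂ (inj₂ d) = ⊥-elim (VertexDisjoint⇒¬shared d (Incident-resp (SameEdge-sym f≈f′) w∈f)
                                                          (Incident-resp (SameEdge-sym e≈e′) w∈e))

module _ {M0 Mstar : List Edge} {a u v b : Vertex} where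

  ComponentIsPath-reverse : ComponentIsPath M0 Mstar a u v b → ComponentIsPath M0 Mstar b v u a
  ComponentIsPath-reverse ((a≢u , a≢v , a≢b , u≢v , u≢b , v≢b) , uv , au , vb , closed) =
    (≢-sym v≢b , ≢-sym u≢b , ≢-sym a≢b , ≢-sym u≢v , ≢-sym a≢v , ≢-sym a≢u) ,
    ∈ₑ-swap uv , ∈ₑ-swap vb , ∈ₑ-swap au , closed′
    where
      swap-incident : ∀ {e} → Incident b e ⊎ Incident v e ⊎ Incident u e ⊎ Incident a e →
                      Incident a e ⊎ Incident u e ⊎ Incident v e ⊎ Incident b e
      swap-incident (inj₁ i)               = inj₂ (inj₂ (inj₂ i))
      swap-incident (inj₂ (inj₁ i))        = inj₂ (inj₂ (inj₁ i))
      swap-incident (inj₂ (inj₂ (inj₁ i))) = inj₂ (inj₁ i)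
      swap-incident (inj₂ (inj₂ (inj₂ i))) = inj₁ i

      closed′ : ∀ e → e ∈ₑ M0 ⊎ e ∈ₑ Mstar →
                Incident b e ⊎ Incident v e ⊎ Incident u e ⊎ Incident a e →
                SameEdge e (b , v) ⊎ SameEdge e (v , u) ⊎ SameEdge e (u , a)
      closed′ e e∈ i with closed e e∈ (swap-incident i)
      ... | inj₁ e≈au        = inj₂ (inj₂ (SameEdge-trans e≈au (SameEdge-swap a u)))
      ... | inj₂ (inj₁ e≈uv) = inj₂ (inj₁ (SameEdge-trans e≈uv (SameEdge-swap u v)))
      ... | inj₂ (inj₂ e≈vb) = inj₁ (SameEdge-trans e≈vb (SameEdge-swap v b))

  pathEnd-partner : ComponentIsPath M0 Mstar a u v b → ∀ {z} → (a , z) ∈ₑ Mstar → z ≡ u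
  pathEnd-partner ((a≢u , a≢v , a≢b , _) , _ , _ , _ , closed) {z} az
    with closed (a , z) (inj₂ az) (inj₁ (inj₁ refl))
  ... | inj₁ (inj₁ (_ , z≡u))        = z≡u
  ... | inj₁ (inj₂ (a≡u , _))        = ⊥-elim (a≢u a≡u)
  ... | inj₂ (inj₁ (inj₁ (a≡u , _))) = ⊥-elim (a≢u a≡u)
  ... | inj₂ (inj₁ (inj₂ (a≡v , _))) = ⊥-elim (a≢v a≡v)
  ... | inj₂ (inj₂ (inj₁ (a≡v , _))) = ⊥-elim (a≢v a≡v)
  ... | inj₂ (inj₂ (inj₂ (a≡b , _))) = ⊥-elim (a≢b a≡b)

  pathEnd-exposed : AllPairs VertexDisjoint M0 → ComponentIsPath M0 Mstar a u v b → ¬ Covered M0 a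
  pathEnd-exposed M0-disjoint ((a≢u , a≢v , _) , uv , _ , _ , closed) (f , f∈M0 , a∈f) =
    a∉uv (Incident-resp (SameEdge-sym f≈uv) a∈f)
    where
      a∉uv : ¬ Incident a (u , v)
      a∉uv (inj₁ a≡u) = a≢u a≡u
      a∉uv (inj₂ a≡v) = a≢v a≡v

      f≈uv : SameEdge f (u , v)
      f≈uv with closed f (inj₁ (∈⇒∈ₑ f∈M0)) (inj₁ a∈f)
      ... | inj₁ f≈au        = matching-shared M0-disjoint (∈⇒∈ₑ f∈M0) uv
                                 (Incident-resp f≈au (inj₂ refl)) (inj₁ refl)
      ... | inj₂ (inj₁ f≈uv) = f≈uv
      ... | inj₂ (inj₂ f≈vb) = matching-shared M0-disjoint (∈⇒∈ₑ f∈M0) uv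
                                 (Incident-resp f≈vb (inj₁ refl)) (inj₂ refl)

incidence : Vertex → Edge → ℕ
incidence w (p , q) = if (w ≡ᵇ p) ∨ (w ≡ᵇ q) then 1 else 0

incidence-cases : ∀ w e → (Incident w e × incidence w e ≡ 1) ⊎ (¬ Incident w e × incidence w e ≡ 0)
incidence-cases w (p , q) with w ≡ᵇ p in w≡ᵇp | w ≡ᵇ q in w≡ᵇq
... | true  | _     = inj₁ (inj₁ (≡ᵇ⇒≡ w p (subst T (sym w≡ᵇp) tt)) , refl)
... | false | true  = inj₁ (inj₂ (≡ᵇ⇒≡ w q (subst T (sym w≡ᵇq) tt)) , refl)
... | false | false = inj₂ (w∉pq , refl)
  where
    w∉pq : ¬ Incident w (p , q)
    w∉pq (inj₁ w≡p) = subst T w≡ᵇp (≡⇒≡ᵇ w p w≡p)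
    w∉pq (inj₂ w≡q) = subst T w≡ᵇq (≡⇒≡ᵇ w q w≡q)

incidence≡1 : ∀ {w e} → Incident w e → incidence w e ≡ 1
incidence≡1 {w} {e} w∈e with incidence-cases w e
... | inj₁ (_ , i≡1)   = i≡1
... | inj₂ (w∉e , _)   = ⊥-elim (w∉e w∈e)

incidence≡0 : ∀ {w e} → ¬ Incident w e → incidence w e ≡ 0
incidence≡0 {w} {e} w∉e with incidence-cases w e
... | inj₁ (w∈e , _)   = ⊥-elim (w∉e w∈e)
... | inj₂ (_ , i≡0)   = i≡0

incidence≤1 : ∀ w e → incidence w e ≤ 1
incidence≤1 w e with incidence-cases w e
... | inj₁ (_ , i≡1) = ≤-reflexive i≡1
... | inj₂ (_ , i≡0) = ≤-trans (≤-reflexive i≡0) z≤n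

degS-∷-mono : ∀ w e S → degS w S ≤ degS w (e ∷ S)
degS-∷-mono w e S = m≤n+m (degS w S) (incidence w e)

degS-pos⇒incident : ∀ {w} S → 1 ≤ degS w S → ∃[ f ] (f ∈ S × Incident w f)
degS-pos⇒incident {w} (e ∷ S) pos with incidence-cases w e
... | inj₁ (w∈e , _) = e , here refl , w∈e
... | inj₂ (_ , i≡0) with degS-pos⇒incident S (subst (λ k → 1 ≤ k + degS w S) i≡0 pos)
...   | f , f∈S , w∈f = f , there f∈S , w∈f

degS≡0 : ∀ {w} S → (∀ {f} → f ∈ S → ¬ Incident w f) → degS w S ≡ 0
degS≡0 []      _    = refl
degS≡0 (e ∷ S) none = cong₂ _+_ (incidence≡0 (none (here refl))) (degS≡0 S (none ∘ there))

degS≤1 : ∀ {w g} S → AllPairs Distinct S → (∀ {f} → f ∈ S → Incident w f → SameEdge f g) → degS w S ≤ 1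
degS≤1     []      _                  _    = z≤n
degS≤1 {w} (e ∷ S) (e∉S ∷ S-distinct) same with incidence-cases w e
... | inj₁ (w∈e , i≡1) = ≤-reflexive (cong₂ _+_ i≡1 (degS≡0 S only-e))
  where
    only-e : ∀ {f} → f ∈ S → ¬ Incident w f
    only-e f∈S w∈f = All.lookup e∉S f∈S
      (SameEdge-trans (same (here refl) w∈e) (SameEdge-sym (same (there f∈S) w∈f)))
... | inj₂ (_ , i≡0) = subst (λ k → k + degS w S ≤ 1) (sym i≡0) (degS≤1 S S-distinct (same ∘ there))

degSum : List Vertex → List Edge → ℕ
degSum ws S = sum (map (λ w → degS w S) ws)

hits : List Vertex → Edge → ℕ
hits ws e = sum (map (λ w → incidence w e) ws)

degSum-∷ : ∀ ws e S → degSum ws (e ∷ S) ≡ hits ws e + degSum ws S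
degSum-∷ []       e S = refl
degSum-∷ (w ∷ ws) e S = begin
  (incidence w e + degS w S) + degSum ws (e ∷ S)         ≡⟨ cong (_ +_) (degSum-∷ ws e S) ⟩
  (incidence w e + degS w S) + (hits ws e + degSum ws S) ≡⟨ interchange +-commutativeSemigroup
                                                              (incidence w e) (degS w S) (hits ws e) (degSum ws S) ⟩
  (incidence w e + hits ws e) + (degS w S + degSum ws S) ∎
  where open ≡-Reasoning

length≤degSum : ∀ ws S → All (λ e → 1 ≤ hits ws e) S → length S ≤ degSum ws S
length≤degSum ws []      []          = z≤n
length≤degSum ws (e ∷ S) (hit ∷ hits) =
  subst (suc (length S) ≤_) (sym (degSum-∷ ws e S)) (+-mono-≤ hit (length≤degSum ws S hits))

degSum-[] : ∀ ws → degSum ws [] ≡ 0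
degSum-[] []       = refl
degSum-[] (_ ∷ ws) = degSum-[] ws

degSum≤length : ∀ ws S → All (λ e → hits ws e ≤ 1) S → degSum ws S ≤ length S
degSum≤length ws []      []          = ≤-reflexive (degSum-[] ws)
degSum≤length ws (e ∷ S) (hit ∷ hits) =
  subst (_≤ suc (length S)) (sym (degSum-∷ ws e S)) (+-mono-≤ hit (degSum≤length ws S hits))

hits-pos : ∀ {w e} ws → w ∈ ws → Incident w e → 1 ≤ hits ws e
hits-pos (w ∷ ws) (here refl) w∈e = ≤-trans (≤-reflexive (sym (incidence≡1 w∈e))) (m≤m+n _ _)
hits-pos (w ∷ ws) (there w∈ws) v∈e = ≤-trans (hits-pos ws w∈ws v∈e) (m≤n+m _ _)

hits≤1 : ∀ {x y} ws → Unique ws → All (_≢ y) ws → hits ws (x , y) ≤ 1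
hits≤1         []       _                  _            = z≤n
hits≤1 {x} {y} (w ∷ ws) (w∉ws ∷ ws-unique) (w≢y ∷ ws≢y) with w ≟ x
... | yes refl = subst (λ k → incidence w (x , y) + k ≤ 1) (sym (hits≡0 ws (All.map ≢-sym w∉ws) ws≢y))
                   (≤-trans (≤-reflexive (+-identityʳ _)) (incidence≤1 w (x , y)))
  where
    hits≡0 : ∀ vs → All (_≢ x) vs → All (_≢ y) vs → hits vs (x , y) ≡ 0
    hits≡0 []       _              _              = refl
    hits≡0 (v ∷ vs) (v≢x ∷ vs≢x) (v≢y ∷ vs≢y) =
      cong₂ _+_ (incidence≡0 λ { (inj₁ v≡x) → v≢x v≡x ; (inj₂ v≡y) → v≢y v≡y }) (hits≡0 vs vs≢x vs≢y)
... | no w≢x = subst (λ k → k + hits ws (x , y) ≤ 1)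
                 (sym (incidence≡0 λ { (inj₁ w≡x) → w≢x w≡x ; (inj₂ w≡y) → w≢y w≡y }))
                 (hits≤1 ws ws-unique ws≢y)

length*≤degSum : ∀ {l} ws S → All (λ w → l ≤ degS w S) ws → length ws * l ≤ degSum ws S
length*≤degSum []       S []        = z≤n
length*≤degSum (w ∷ ws) S (l≤ ∷ l≤s) = +-mono-≤ l≤ (length*≤degSum ws S l≤s)

endpoints : List Edge → List Vertex
endpoints []            = []
endpoints ((p , q) ∷ M) = p ∷ q ∷ endpoints M

Covered⇒∈endpoints : ∀ {w} M → Covered M w → w ∈ endpoints M
Covered⇒∈endpoints (_ ∷ M) (_ , here refl , inj₁ refl) = here refl
Covered⇒∈endpoints (_ ∷ M) (_ , here refl , inj₂ refl) = there (here refl)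
Covered⇒∈endpoints ((p , q) ∷ M) (f , there f∈M , w∈f) = there (there (Covered⇒∈endpoints M (f , f∈M , w∈f)))

degSum-endpoints≤ : ∀ {l} M S → All (λ { (p , q) → degS p S + degS q S ≤ l }) M →
                    degSum (endpoints M) S ≤ length M * l
degSum-endpoints≤ []            S []          = z≤n
degSum-endpoints≤ {l} ((p , q) ∷ M) S (pq≤ ∷ M≤) =
  subst (_≤ length ((p , q) ∷ M) * l) (+-assoc (degS p S) (degS q S) (degSum (endpoints M) S))
    (+-mono-≤ pq≤ (degSum-endpoints≤ M S M≤))

module _ {M0 : List Edge} {lamU lamM : ℕ} where

  step-degS-mono : ∀ {st e st′} w → Step M0 lamU lamM st e st′ → degS w (S st) ≤ degS w (S st′)
  step-degS-mono      w (ignore-blocked _)                  = ≤-refl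
  step-degS-mono      w (ignore-M0 _ _ _ _)                 = ≤-refl
  step-degS-mono      w (aug _ _ _ _ _ _ _ _)               = ≤-refl
  step-degS-mono {st} w (add {x = x} {y} _ _ _ _ _ _ _ _) = degS-∷-mono w (x , y) (S st)
  step-degS-mono      w (skip _ _ _ _ _ _ _)                = ≤-refl

  run-degS-mono : ∀ {st es h fin} w → Run M0 lamU lamM st es h fin → degS w (S st) ≤ degS w (S fin)
  run-degS-mono w done              = ≤-refl
  run-degS-mono w (step first rest) = ≤-trans (step-degS-mono w first) (run-degS-mono w rest)

  history-degS-mono : ∀ {st es h fin e′ st′} w → Run M0 lamU lamM st es h fin → (e′ , st′) ∈ h →
                      degS w (S st′) ≤ degS w (S fin)
  history-degS-mono w run@(step _ _) (here refl) = run-degS-mono w run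
  history-degS-mono w (step _ rest)  (there e∈h) = history-degS-mono w rest e∈h

+-≤-byPositivity : ∀ {m n o} → m ≤ o → n ≤ o → (1 ≤ m → 1 ≤ n → m + n ≤ o) → m + n ≤ o
+-≤-byPositivity {zero}              _   n≤o _    = n≤o
+-≤-byPositivity {suc m} {zero} {o} m≤o _   _    = subst (_≤ o) (sym (+-identityʳ (suc m))) m≤o
+-≤-byPositivity {suc m} {suc n}     _   _   both = both (s≤s z≤n) (s≤s z≤n)

module ImproveMatching (L M0 : List Edge) (lamU lamM : ℕ) where

  Oriented : Edge → Set
  Oriented (x , y) = ¬ Covered M0 x × Covered M0 y

  record Invariant (S es : List Edge) : Set where
    field
      stream⊆L           : All (_∈ L) es
      stream-distinct    : AllPairs Distinct es
      S⊆L                : All (_∈ₑ L) S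
      S-distinct         : AllPairs Distinct S
      S-fresh            : All (λ s → All (Distinct s) es) S
      S-oriented         : All Oriented S
      covered-degS≤λM    : ∀ {w} → Covered M0 w → degS w S ≤ lamM
      S-neighbours-agree : ∀ {p q c b} → (p , q) ∈ₑ M0 → (c , p) ∈ₑ S → (b , q) ∈ₑ S → c ≡ b
  open Invariant

  Invariant-init : AllPairs Distinct L → Invariant [] L
  Invariant-init L-distinct = record
    { stream⊆L = All.tabulate (λ e∈L → e∈L) ; stream-distinct = L-distinct
    ; S⊆L = [] ; S-distinct = [] ; S-fresh = [] ; S-oriented = []
    ; covered-degS≤λM = λ _ → z≤n ; S-neighbours-agree = λ { _ (_ , () , _) _ } }

  Invariant-drop : ∀ {S e es} → Invariant S (e ∷ es) → Invariant S es
  Invariant-drop inv = record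
    { stream⊆L = All.tail (stream⊆L inv) ; stream-distinct = AllPairs.tail (stream-distinct inv)
    ; S⊆L = S⊆L inv ; S-distinct = S-distinct inv ; S-fresh = All.map All.tail (S-fresh inv)
    ; S-oriented = S-oriented inv ; covered-degS≤λM = covered-degS≤λM inv
    ; S-neighbours-agree = S-neighbours-agree inv }

  new-neighbour : ∀ {S c w x y} → ¬ Covered M0 x → Covered M0 w → (c , w) ∈ₑ ((x , y) ∷ S) →
                  (c ≡ x × w ≡ y) ⊎ (c , w) ∈ₑ S
  new-neighbour x∉M0 w∈M0 cw with ∈ₑ-∷⁻ cw
  ... | inj₁ (inj₁ cw≡xy)      = inj₁ cw≡xy
  ... | inj₁ (inj₂ (_ , refl)) = ⊥-elim (x∉M0 w∈M0)
  ... | inj₂ cw∈S              = inj₂ cw∈S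

  Invariant-add : ∀ {S e es x y} → Invariant S (e ∷ es) → SameEdge e (x , y) →
                  ¬ Covered M0 x → Covered M0 y →
                  (∀ {v b} → (y , v) ∈ₑ M0 → (b , v) ∈ₑ S → b ≡ x) →
                  degS y S < lamM → Invariant ((x , y) ∷ S) es
  Invariant-add {S} {e} {es} {x} {y} inv e≈xy x∉M0 y∈M0 partner-neighbours≡x y<λM = record
    { stream⊆L = All.tail (stream⊆L inv)
    ; stream-distinct = AllPairs.tail (stream-distinct inv)
    ; S⊆L = (e , All.head (stream⊆L inv) , SameEdge-sym e≈xy) ∷ S⊆L inv
    ; S-distinct = xy∉S ∷ S-distinct inv
    ; S-fresh = xy-fresh ∷ All.map All.tail (S-fresh inv)
    ; S-oriented = (x∉M0 , y∈M0) ∷ S-oriented inv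
    ; covered-degS≤λM = degS≤λM
    ; S-neighbours-agree = agree }
    where
      xy∉S : All (Distinct (x , y)) S
      xy∉S = All.map (λ s≠e xy≈s → All.head s≠e (SameEdge-trans (SameEdge-sym xy≈s) (SameEdge-sym e≈xy)))
                     (S-fresh inv)

      xy-fresh : All (Distinct (x , y)) es
      xy-fresh = All.map (λ e≠f xy≈f → e≠f (SameEdge-trans e≈xy xy≈f)) (AllPairs.head (stream-distinct inv))

      degS≤λM : ∀ {w} → Covered M0 w → degS w ((x , y) ∷ S) ≤ lamM
      degS≤λM {w} w∈M0 with w ≟ y
      ... | yes refl = ≤-trans (+-monoˡ-≤ (degS w S) (incidence≤1 w (x , y))) y<λM
      ... | no w≢y   = subst (λ k → k + degS w S ≤ lamM)
                         (sym (incidence≡0 {w} {x , y} λ { (inj₁ refl) → x∉M0 w∈M0 ; (inj₂ w≡y) → w≢y w≡y }))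
                         (covered-degS≤λM inv w∈M0)

      agree : ∀ {p q c b} → (p , q) ∈ₑ M0 → (c , p) ∈ₑ ((x , y) ∷ S) → (b , q) ∈ₑ ((x , y) ∷ S) → c ≡ b
      agree pq cp bq with new-neighbour x∉M0 (covered₁ pq) cp | new-neighbour x∉M0 (covered₂ pq) bq
      ... | inj₁ (refl , _)    | inj₁ (refl , _)    = refl
      ... | inj₁ (refl , refl) | inj₂ bq∈S          = sym (partner-neighbours≡x pq bq∈S)
      ... | inj₂ cp∈S          | inj₁ (refl , refl) = partner-neighbours≡x (∈ₑ-swap pq) cp∈S
      ... | inj₂ cp∈S          | inj₂ bq∈S          = S-neighbours-agree inv pq cp∈S bq∈S

  unclosed⇒partner-neighbours≡ : ∀ {st x y} → ¬ (∃[ v ] ∃[ b ] Closes M0 st x y v b) →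
                                 ∀ {v b} → (y , v) ∈ₑ M0 → (b , v) ∈ₑ S st → b ≡ x
  unclosed⇒partner-neighbours≡ {x = x} unclosed {v} {b} yv bv with b ≟ x
  ... | yes b≡x = b≡x
  ... | no b≢x  = ⊥-elim (unclosed (v , b , yv , ∈ₑ-swap bv , b≢x))

  Invariant-step : ∀ {st e st′ es} → Step M0 lamU lamM st e st′ → Invariant (S st) (e ∷ es) → Invariant (S st′) es
  Invariant-step (ignore-blocked _)    = Invariant-drop
  Invariant-step (ignore-M0 _ _ _ _)   = Invariant-drop
  Invariant-step (aug _ _ _ _ _ _ _ _) = Invariant-drop
  Invariant-step (skip _ _ _ _ _ _ _)  = Invariant-drop
  Invariant-step {st} (add e≈xy _ _ x∉M0 y∈M0 unclosed _ y<λM) inv =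
    Invariant-add inv e≈xy x∉M0 y∈M0 (unclosed⇒partner-neighbours≡ {st} unclosed) y<λM

  Invariant-run : ∀ {st es h fin} → Run M0 lamU lamM st es h fin → Invariant (S st) es → Invariant (S fin) []
  Invariant-run done              inv = inv
  Invariant-run (step first rest) inv = Invariant-run rest (Invariant-step first inv)

  module _ {S : List Edge} (inv : Invariant S []) where

    S-edge-at : ∀ {f w} → f ∈ S → Incident w f → Covered M0 w → ∃[ c ] f ≡ (c , w)
    S-edge-at f∈S (inj₁ refl) w∈M0 = ⊥-elim (proj₁ (All.lookup (S-oriented inv) f∈S) w∈M0)
    S-edge-at f∈S (inj₂ refl) _    = _ , refl

    S-neighbour : ∀ {w} → Covered M0 w → 1 ≤ degS w S → ∃[ c ] (c , w) ∈ S
    S-neighbour w∈M0 pos with degS-pos⇒incident S pos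
    ... | f , f∈S , w∈f with S-edge-at f∈S w∈f w∈M0
    ...   | c , refl = c , f∈S

    unique-neighbour⇒degS≤1 : ∀ {w c} → Covered M0 w → (∀ {c′} → (c′ , w) ∈ₑ S → c′ ≡ c) → degS w S ≤ 1
    unique-neighbour⇒degS≤1 {w} {c} w∈M0 only-c = degS≤1 {g = c , w} S (S-distinct inv) edge≈cw
      where
        edge≈cw : ∀ {f} → f ∈ S → Incident w f → SameEdge f (c , w)
        edge≈cw f∈S w∈f with S-edge-at f∈S w∈f w∈M0
        ... | c′ , refl = inj₁ (only-c (∈⇒∈ₑ f∈S) , refl)

    endpoint-degS≤λM : TriangleFree L ⊎ 2 ≤ lamM → ∀ {p q} → (p , q) ∈ₑ L → (p , q) ∈ₑ M0 →
                       degS p S + degS q S ≤ lamM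
    endpoint-degS≤λM triangle-free⊎2≤λM {p} {q} pq∈L pq =
      +-≤-byPositivity (covered-degS≤λM inv p∈M0) (covered-degS≤λM inv q∈M0) both-positive
      where
        p∈M0 = covered₁ pq
        q∈M0 = covered₂ pq

        both-positive : 1 ≤ degS p S → 1 ≤ degS q S → degS p S + degS q S ≤ lamM
        both-positive p-pos q-pos with S-neighbour p∈M0 p-pos | S-neighbour q∈M0 q-pos
        ... | c , cp | b , bq with S-neighbours-agree inv pq (∈⇒∈ₑ cp) (∈⇒∈ₑ bq)
        ... | refl = [ (λ triangle-free → ⊥-elim (triangle-free c p q (All.lookup (S⊆L inv) cp) pq∈L
                                                                          (All.lookup (S⊆L inv) bq)))
                     , ≤-trans (+-mono-≤ p≤1 q≤1) ]′ triangle-free⊎2≤λM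
          where
            p≤1 = unique-neighbour⇒degS≤1 p∈M0 (λ c′p → S-neighbours-agree inv pq c′p (∈⇒∈ₑ bq))
            q≤1 = unique-neighbour⇒degS≤1 q∈M0 (λ c′q → sym (S-neighbours-agree inv pq (∈⇒∈ₑ cp) c′q))

    length-S≤length-M0*λM : TriangleFree L ⊎ 2 ≤ lamM → All (_∈ₑ L) M0 → length S ≤ length M0 * lamM
    length-S≤length-M0*λM triangle-free⊎2≤λM M0⊆L = begin
      length S                ≤⟨ length≤degSum (endpoints M0) S (All.map hits-M0 (S-oriented inv)) ⟩
      degSum (endpoints M0) S ≤⟨ degSum-endpoints≤ M0 S (All.tabulate edge-bound) ⟩
      length M0 * lamM        ∎
      where
        open ≤-Reasoning
        hits-M0 : ∀ {e} → Oriented e → 1 ≤ hits (endpoints M0) e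
        hits-M0 (_ , y∈M0) = hits-pos (endpoints M0) (Covered⇒∈endpoints M0 y∈M0) (inj₂ refl)
        edge-bound : ∀ {e} → e ∈ M0 → degS (proj₁ e) S + degS (proj₂ e) S ≤ lamM
        edge-bound e∈M0 = endpoint-degS≤λM triangle-free⊎2≤λM (All.lookup M0⊆L e∈M0) (∈⇒∈ₑ e∈M0)

module _ {A B : Set} {P : A → Set} (f : ∀ {x} → P x → B) where

  length-reduce : ∀ {xs} (ps : All P xs) → length (reduce f ps) ≡ length xs
  length-reduce []       = refl
  length-reduce (_ ∷ ps) = cong suc (length-reduce ps)

  reduce⁺ : ∀ {Q : B → Set} {xs} → (∀ {x} (px : P x) → Q (f px)) → (ps : All P xs) → All Q (reduce f ps)
  reduce⁺ q []        = []
  reduce⁺ q (px ∷ ps) = q px ∷ reduce⁺ q ps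

  reduce-All⁺ : ∀ {Q : A → Set} {Q′ : B → Set} {xs} → (∀ {x} (px : P x) → Q x → Q′ (f px)) →
                All Q xs → (ps : All P xs) → All Q′ (reduce f ps)
  reduce-All⁺ q []        []        = []
  reduce-All⁺ q (qx ∷ qs) (px ∷ ps) = q px qx ∷ reduce-All⁺ q qs ps

  AllPairs-reduce⁺ : ∀ {R : A → A → Set} {R′ : B → B → Set} {xs} →
                     (∀ {x y} (px : P x) (py : P y) → R x y → R′ (f px) (f py)) →
                     AllPairs R xs → (ps : All P xs) → AllPairs R′ (reduce f ps)
  AllPairs-reduce⁺ r []         []        = []
  AllPairs-reduce⁺ r (rx ∷ rxs) (px ∷ ps) = reduce-All⁺ (r px) rx ps ∷ AllPairs-reduce⁺ r rxs ps

module BadEdges (M0 Mstar : List Edge) (lamU : ℕ) where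

  record FullEnd (S : List Edge) (e : Edge) (w : Vertex) : Set where
    field
      exposed     : ¬ Covered M0 w
      full        : lamU ≤ degS w S
      partner     : Vertex
      partner∈M*  : (w , partner) ∈ₑ Mstar
      partners-on : ∀ {z} → (w , z) ∈ₑ Mstar → Incident z e
  open FullEnd

  pathEnd⇒FullEnd : ∀ {S e a u v b} → AllPairs VertexDisjoint M0 → SameEdge e (u , v) →
                    ComponentIsPath M0 Mstar a u v b → lamU ≤ degS a S → FullEnd S e a
  pathEnd⇒FullEnd {e = e} {u = u} M0-disjoint e≈uv path a-full = record
    { exposed = pathEnd-exposed M0-disjoint path
    ; full = a-full
    ; partner = u
    ; partner∈M* = proj₁ (proj₂ (proj₂ path))
    ; partners-on = λ az → subst (λ z → Incident z e) (sym (pathEnd-partner path az))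
                                 (Incident-resp e≈uv (inj₁ refl)) }

  Bad⇒FullEnd : ∀ {lamM st es h fin e} → AllPairs VertexDisjoint M0 → Run M0 lamU lamM st es h fin →
                Bad M0 Mstar lamU h fin e → ∃ (FullEnd (S fin) e)
  Bad⇒FullEnd M0-disjoint run (a , u , v , b , e≈uv , path , _ , inj₁ (_ , _ , arrival , _ , a-full)) =
    a , pathEnd⇒FullEnd M0-disjoint e≈uv path
          (subst (_≤ _) a-full (history-degS-mono a run arrival))
  Bad⇒FullEnd M0-disjoint run (a , u , v , b , e≈uv , path , _ , inj₂ (_ , _ , arrival , _ , b-full)) =
    b , pathEnd⇒FullEnd M0-disjoint (SameEdge-trans e≈uv (SameEdge-swap u v)) (ComponentIsPath-reverse path)
          (subst (_≤ _) b-full (history-degS-mono b run arrival))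

  FullEnd-distinct : ∀ {S e f w w′} → VertexDisjoint e f → FullEnd S e w → FullEnd S f w′ → w ≢ w′
  FullEnd-distinct e∩f=∅ end end′ refl =
    VertexDisjoint⇒¬shared e∩f=∅ (partners-on end (partner∈M* end)) (partners-on end′ (partner∈M* end))

  length*λU≤length-S : ∀ {B S} → AllPairs VertexDisjoint B → All (λ e → ∃ (FullEnd S e)) B →
                       All (λ s → Covered M0 (proj₂ s)) S → length B * lamU ≤ length S
  length*λU≤length-S {B} {S} B-disjoint ends S-into-M0 = begin
    length B * lamU  ≡⟨ cong (_* lamU) (length-reduce proj₁ ends) ⟨
    length ws * lamU ≤⟨ length*≤degSum ws S (reduce⁺ proj₁ (full ∘ proj₂) ends) ⟩
    degSum ws S      ≤⟨ degSum≤length ws S (All.map (hits≤1 ws ws-unique ∘ ws≢) S-into-M0) ⟩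
    length S         ∎
    where
      open ≤-Reasoning
      ws = reduce proj₁ ends
      ws-unique : Unique ws
      ws-unique = AllPairs-reduce⁺ proj₁ (λ (_ , end) (_ , end′) e∩f=∅ → FullEnd-distinct e∩f=∅ end end′)
                    B-disjoint ends
      ws≢ : ∀ {y} → Covered M0 y → All (_≢ y) ws
      ws≢ y∈M0 = reduce⁺ proj₁ (λ (_ , end) → λ { refl → exposed end y∈M0 }) ends

lemma5p4 : (L M0 Mstar : List Edge) (lamU lamM : ℕ) →
    SimpleStream L → IsMaximalMatching L M0 → IsMaximumMatching L Mstar →
    1 ≤ lamU → 1 ≤ lamM → (TriangleFree L ⊎ 2 ≤ lamM) →
    (h : List (Edge × State)) (fin : State) →
    Run M0 lamU lamM (initState M0) L h fin →
    (B : List Edge) → B ⊆ M0 → All (Bad M0 Mstar lamU h fin) B →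
    length B * lamU ≤ lamM * length M0
lemma5p4 L M0 Mstar lamU lamM (_ , L-distinct) ((M0⊆L , M0-disjoint) , _) _ _ _ triangle-free⊎2≤λM
         _ fin run B B⊆M0 bad = begin
  length B * lamU  ≤⟨ length*λU≤length-S (AllPairs-resp-⊆ B⊆M0 M0-disjoint)
                        (All.map (Bad⇒FullEnd M0-disjoint run) bad) (All.map proj₂ (Invariant.S-oriented inv)) ⟩
  length (S fin)   ≤⟨ length-S≤length-M0*λM inv triangle-free⊎2≤λM M0⊆L ⟩
  length M0 * lamM ≡⟨ *-comm (length M0) lamM ⟩
  lamM * length M0 ∎
  where
    open ≤-Reasoning
    open ImproveMatching L M0 lamU lamM
    open BadEdges M0 Mstar lamU
    inv : Invariant (S fin) []
    inv = Invariant-run run (Invariant-init L-distinct)
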